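{- Let $G$ be an $n$-vertex $\alpha$-critical graph in $\mathbf W_p$, with $r=\alpha(G)\ge2$, and let $H=\overline G$. If $\delta(H)>\frac{3r-4}{3r-1}n$, then $H$ is complete $r$-partite; equivalently, $G$ is the disjoint union of $r$ complete graphs. Moreover, each of these $r$ complete graphs has at least $p$ vertices.
   Context: All graphs are finite, simple and non-empty; $p\ge1$ is an integer. $\alpha(G)$ is the independence number. $G\in\mathbf W_p$ means: $|V(G)|\ge p$ and any $p$ pairwise disjoint independent sets $A_1,\dots,A_p$ extend to pairwise disjoint maximum independent sets $M_i\supseteq A_i$. An edge $e$ is $\alpha$-critical if $\alpha(G-e)>\alpha(G)$; $G$ is $\alpha$-critical if all edges are. $\delta(H)$ is the minimum degree of $H$; a graph is complete $r$-partite if its vertices partition into $r$ independent sets with all pairs from different parts adjacent. -}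

module Defs where

open import Data.Nat using (ℕ; zero; suc; _+_; _*_; _∸_; _≤_; _<_; _⊓_)
open import Data.Bool using (Bool; true; false; not; if_then_else_; _∧_; _∨_)
open import Data.Fin using (Fin)
open import Data.Fin.Properties using () renaming (_≟_ to _≟ᶠ_)
open import Data.Fin.Subset using (Subset; _∈_; _⊆_; ∣_∣)
open import Data.Vec using (tabulate)
open import Data.List using (foldr; allFin)
open import Data.Product using (Σ; ∃; _×_; _,_)
open import Data.Empty using (⊥)
open import Relation.Binary.PropositionalEquality using (_≡_; _≢_)
open import Relation.Nullary.Decidable using (⌊_⌋)

Graph : ℕ → Set
Graph n = Fin n → Fin n → Bool

IsSimple : ∀ {n} → Graph n → Set
IsSimple {n} G = (∀ (i j : Fin n) → G i j ≡ G j i) × (∀ (i : Fin n) → G i i ≡ false)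

complement : ∀ {n} → Graph n → Graph n
complement G i j = if ⌊ i ≟ᶠ j ⌋ then false else not (G i j)

deleteEdge : ∀ {n} → Graph n → Fin n → Fin n → Graph n
deleteEdge G u v i j =
  if (⌊ i ≟ᶠ u ⌋ ∧ ⌊ j ≟ᶠ v ⌋) ∨ (⌊ i ≟ᶠ v ⌋ ∧ ⌊ j ≟ᶠ u ⌋) then false else G i j

Independent : ∀ {n} → Graph n → Subset n → Set
Independent {n} G S = ∀ (i j : Fin n) → i ∈ S → j ∈ S → G i j ≡ false

IsIndepNumber : ∀ {n} → Graph n → ℕ → Set
IsIndepNumber {n} G r =
  (Σ (Subset n) λ S → Independent G S × ∣ S ∣ ≡ r) ×
  (∀ (T : Subset n) → Independent G T → ∣ T ∣ ≤ r)

IsMaximumIndep : ∀ {n} → Graph n → Subset n → Set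
IsMaximumIndep {n} G S = Independent G S × (∀ (T : Subset n) → Independent G T → ∣ T ∣ ≤ ∣ S ∣)

Disjoint : ∀ {n} → Subset n → Subset n → Set
Disjoint {n} A B = ∀ (x : Fin n) → x ∈ A → x ∈ B → ⊥

InW : ℕ → ∀ {n} → Graph n → Set
InW p {n} G =
  p ≤ n ×
  (∀ (A : Fin p → Subset n) →
     (∀ i → Independent G (A i)) →
     (∀ i j → i ≢ j → Disjoint (A i) (A j)) →
     Σ (Fin p → Subset n) λ M →
       (∀ i → IsMaximumIndep G (M i)) ×
       (∀ i → A i ⊆ M i) ×
       (∀ i j → i ≢ j → Disjoint (M i) (M j)))

IsAlphaCriticalEdge : ∀ {n} → Graph n → Fin n → Fin n → Set
IsAlphaCriticalEdge G u v =
  ∀ r s → IsIndepNumber G r → IsIndepNumber (deleteEdge G u v) s → r < s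

IsAlphaCritical : ∀ {n} → Graph n → Set
IsAlphaCritical {n} G = ∀ (u v : Fin n) → G u v ≡ true → IsAlphaCriticalEdge G u v

-- degree and minimum degree (δ for a graph on n ≥ 1 vertices; the
-- initial value n of the fold exceeds every degree of a simple graph)
degree : ∀ {n} → Graph n → Fin n → ℕ
degree G v = ∣ tabulate (G v) ∣

δ : ∀ {n} → Graph n → ℕ
δ {n} G = foldr (λ v m → degree G v ⊓ m) n (allFin n)

IsCompleteMultipartiteVia : ∀ {n} → Graph n → (r : ℕ) → (Fin n → Fin r) → Set
IsCompleteMultipartiteVia {n} H r part =
  ∀ (u v : Fin n) → u ≢ v → (H u v ≡ true → part u ≢ part v) × (part u ≢ part v → H u v ≡ true)

partSize : ∀ {n r} → (Fin n → Fin r) → Fin r → ℕ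
partSize part k = ∣ tabulate (λ v → ⌊ part v ≟ᶠ k ⌋) ∣

-- Write N[v] for the closed neighbourhood of v in G and r = α(G). The degree condition on the
-- complement says (3r − 1)|N[v]| < 3n for every v. By double counting, if every vertex is
-- dominated by a set K or lies in a set Z, then (3r − 1)n ≤ 3n|K| + (3r − 1)|Z|.
-- For an α-critical edge uv, an independent set T of G − uv larger than r contains u and v;
-- since T − u and T − v are maximum in G, the r − 1 vertices of T − {u, v} dominate everything
-- outside N[u] ∩ N[v]. For non-adjacent u ≠ w, a maximum independent set through u and w (given
-- by W_p) minus {u, w} dominates everything outside N[u] ∪ N[w]. Hence
-- (3r − 1)|N[u] ∩ N[v]| ≥ 2n and (3r − 1)|N[u] ∪ N[w]| ≥ 5n. If ab and bd were edges but ad not,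
-- adding these bounds would give 9n ≤ (3r − 1)(|N[a]| + |N[b]| + |N[d]|) < 9n. So adjacency is
-- transitive: G is a disjoint union of cliques, one through each vertex of a maximum independent
-- set, and each of p disjoint maximum independent sets meets every clique.

module Submission where

open import Defs
open import Data.Nat using (ℕ; zero; suc; _+_; _*_; _∸_; _⊓_; _≤_; _<_; z≤n; s≤s)
open import Data.Nat.Properties
  using ( +-*-semiring; module ≤-Reasoning; ≤-refl; ≤-reflexive; ≤-trans; ≤-pred; <⇒≤; <⇒≱; ≮⇒≥; <-irrefl
        ; <-≤-trans; _<?_; +-comm; +-identityʳ; *-identityˡ; *-identityʳ; *-zeroʳ; *-distribˡ-+
        ; m≤m+n; m≤n+m; +-mono-≤; +-monoˡ-≤; +-mono-<; +-monoʳ-<; *-monoʳ-≤; +-cancelˡ-≤; +-cancelʳ-<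
        ; m+n∸m≡n; m⊓n≤m; m⊓n≤n )
open import Data.Nat.Tactic.RingSolver using (solve-∀)
open import Algebra.Properties.Semiring.Sum +-*-semiring
  using (sum; sum-syntax; sum-cong-≗; sum-replicate-zero; ∑-distrib-+; ∑-comm; *-distribˡ-sum)
open import Data.Bool using (Bool; true; false; not; _∧_; _∨_)
open import Data.Bool.Properties
  using (∧-identityʳ; ∧-zeroʳ; ∨-identityʳ; ∨-zeroʳ; ¬-not) renaming (_≟_ to _≟𝔹_)
open import Data.Fin using (Fin; zero; suc; cast)
open import Data.Fin.Properties using (_≟_; all?; any?; suc-injective; cast-involutive; injective⇒≤)
open import Data.Fin.Subset using (Subset; inside; outside; _∈_; _⊆_; _∪_; ⁅_⁆; ∣_∣; ⊥)
open import Data.Fin.Subset.Properties using (_∈?_; ∉⊥; anySubset?; x∈⁅x⁆; x∈⁅y⁆⇒x≡y; x∈p∪q⁺; x∈p∪q⁻)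
open import Data.Product using (Σ; _×_; _,_; proj₁; proj₂)
open import Data.Sum using (_⊎_; inj₁; inj₂)
open import Data.Vec using (_∷_; here; there; tabulate; lookup)
open import Data.Vec.Properties using (tabulate∘lookup; lookup∘tabulate; []=⇒lookup; lookup⇒[]=)
open import Data.List using (foldr; allFin) renaming (_∷_ to _∷ₗ_)
import Data.List.Membership.Propositional as List
open import Data.List.Membership.Propositional.Properties using (∈-allFin)
import Data.List.Relation.Unary.Any as Any
open import Function using (_∘_; Injective)
open import Relation.Binary.PropositionalEquality
  using (_≡_; _≢_; refl; sym; trans; cong; cong₂; subst; subst₂; module ≡-Reasoning)
open import Relation.Nullary using (Dec; yes; no; ¬_)
open import Relation.Nullary.Decidable using (⌊_⌋; ⌊⌋-map′; _×-dec_; _→-dec_)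
open import Relation.Nullary.Negation using (contradiction)

private variable
  n : ℕ
  H : Graph n

-- Vertex sets are mostly handled as characteristic functions Fin n → Bool, whose cardinality is a
-- sum and can be double counted; a Subset n is converted with lookup and tabulate.
𝟙 : Bool → ℕ
𝟙 true  = 1
𝟙 false = 0

card : (Fin n → Bool) → ℕ
card {n} P = ∑[ x < n ] 𝟙 (P x)

∑-mono-≤ : ∀ {f g : Fin n → ℕ} → (∀ i → f i ≤ g i) → sum f ≤ sum g
∑-mono-≤ {zero}  f≤g = z≤n
∑-mono-≤ {suc n} f≤g = +-mono-≤ (f≤g zero) (∑-mono-≤ (f≤g ∘ suc))

term≤∑ : ∀ (f : Fin n → ℕ) i → f i ≤ sum f
term≤∑ f zero    = m≤m+n _ _
term≤∑ f (suc i) = ≤-trans (term≤∑ (f ∘ suc) i) (m≤n+m _ _)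

∑-one : ∀ n → ∑[ i < n ] 1 ≡ n
∑-one zero    = refl
∑-one (suc n) = cong suc (∑-one n)

_≡ᵇ_ : Fin n → Fin n → Bool
x ≡ᵇ y = ⌊ x ≟ y ⌋

≡ᵇ-refl : ∀ (x : Fin n) → (x ≡ᵇ x) ≡ true
≡ᵇ-refl x with x ≟ x
... | yes _   = refl
... | no x≢x = contradiction refl x≢x

≡ᵇ⇒≡ : ∀ {x y : Fin n} → (x ≡ᵇ y) ≡ true → x ≡ y
≡ᵇ⇒≡ {x = x} {y} x≡ᵇy with x ≟ y
≡ᵇ⇒≡ _  | yes x≡y = x≡y
≡ᵇ⇒≡ () | no _

≢⇒≡ᵇ-false : ∀ {x y : Fin n} → x ≢ y → (x ≡ᵇ y) ≡ false
≢⇒≡ᵇ-false {x = x} {y} x≢y with x ≟ y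
... | yes x≡y = contradiction x≡y x≢y
... | no _    = refl

card-tabulate : ∀ (P : Fin n → Bool) → ∣ tabulate P ∣ ≡ card P
card-tabulate {zero}  P = refl
card-tabulate {suc n} P with P zero
... | true  = cong suc (card-tabulate (P ∘ suc))
... | false = card-tabulate (P ∘ suc)

card-lookup : ∀ (S : Subset n) → ∣ S ∣ ≡ card (lookup S)
card-lookup S = trans (cong ∣_∣ (sym (tabulate∘lookup S))) (card-tabulate (lookup S))

card-≡ᵇ : ∀ (x : Fin n) → card (_≡ᵇ x) ≡ 1
card-≡ᵇ {suc n} zero    = cong suc (sum-replicate-zero n)
card-≡ᵇ {suc n} (suc x) =
  trans (sum-cong-≗ λ y → cong 𝟙 (⌊⌋-map′ (cong suc) suc-injective (y ≟ x))) (card-≡ᵇ x)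

card-split : ∀ {P Q : Fin n → Bool} x →
  (∀ y → 𝟙 (P y) ≡ 𝟙 (Q y) + 𝟙 (y ≡ᵇ x)) → card P ≡ suc (card Q)
card-split {n} {P} {Q} x pointwise = begin
  card P                                   ≡⟨ sum-cong-≗ pointwise ⟩
  ∑[ y < n ] (𝟙 (Q y) + 𝟙 (y ≡ᵇ x))        ≡⟨ ∑-distrib-+ (𝟙 ∘ Q) (𝟙 ∘ (_≡ᵇ x)) ⟩
  card Q + card (_≡ᵇ x)                    ≡⟨ cong (card Q +_) (card-≡ᵇ x) ⟩
  card Q + 1                               ≡⟨ +-comm (card Q) 1 ⟩
  suc (card Q)                             ∎
  where open ≡-Reasoning

_∖_ : (Fin n → Bool) → Fin n → (Fin n → Bool)
(P ∖ x) y = P y ∧ not (y ≡ᵇ x)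

card-∖ : ∀ (P : Fin n → Bool) {x} → P x ≡ true → card P ≡ suc (card (P ∖ x))
card-∖ P {x} Px = card-split x pointwise
  where
  pointwise : ∀ y → 𝟙 (P y) ≡ 𝟙 ((P ∖ x) y) + 𝟙 (y ≡ᵇ x)
  pointwise y with y ≟ x
  ... | yes refl rewrite Px = refl
  ... | no _     rewrite ∧-identityʳ (P y) = sym (+-identityʳ _)

card-∪-singleton : ∀ (P : Fin n → Bool) {x} → P x ≡ false →
  card (λ y → P y ∨ y ≡ᵇ x) ≡ suc (card P)
card-∪-singleton P {x} Px = card-split x pointwise
  where
  pointwise : ∀ y → 𝟙 (P y ∨ y ≡ᵇ x) ≡ 𝟙 (P y) + 𝟙 (y ≡ᵇ x)
  pointwise y with y ≟ x
  ... | yes refl rewrite Px = refl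
  ... | no _     rewrite ∨-identityʳ (P y) = sym (+-identityʳ _)

∪-singleton⁻ : ∀ {P : Fin n → Bool} {x y} → (P y ∨ y ≡ᵇ x) ≡ true → P y ≡ true ⊎ y ≡ x
∪-singleton⁻ {P = P} {y = y} P+x∋y with P y
... | true  = inj₁ refl
... | false = inj₂ (≡ᵇ⇒≡ P+x∋y)

∈-∖ : ∀ (P : Fin n → Bool) {x y} → P y ≡ true → y ≢ x → (P ∖ x) y ≡ true
∈-∖ P Py y≢x rewrite Py | ≢⇒≡ᵇ-false y≢x = refl

∖-⊆ : ∀ (P : Fin n → Bool) {x y} → (P ∖ x) y ≡ true → P y ≡ true
∖-⊆ P {y = y} ∈P∖x with P y
... | true = refl

∖-self : ∀ (P : Fin n → Bool) x → (P ∖ x) x ≡ false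
∖-self P x rewrite ≡ᵇ-refl x = ∧-zeroʳ (P x)

∖-≢ : ∀ (P : Fin n → Bool) {x y} → (P ∖ x) y ≡ true → y ≢ x
∖-≢ P {x} ∈P∖x refl with trans (sym ∈P∖x) (∖-self P x)
... | ()

enum : ∀ (S : Subset n) → Fin ∣ S ∣ → Fin n
enum (inside  ∷ S) zero    = zero
enum (inside  ∷ S) (suc k) = suc (enum S k)
enum (outside ∷ S) k       = suc (enum S k)

enum-∈ : ∀ (S : Subset n) k → enum S k ∈ S
enum-∈ (inside  ∷ S) zero    = here
enum-∈ (inside  ∷ S) (suc k) = there (enum-∈ S k)
enum-∈ (outside ∷ S) k       = there (enum-∈ S k)

enum-injective : ∀ (S : Subset n) → Injective _≡_ _≡_ (enum S)
enum-injective (inside  ∷ S) {zero}  {zero}  _  = refl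
enum-injective (inside  ∷ S) {suc k} {suc l} eq = cong suc (enum-injective S (suc-injective eq))
enum-injective (outside ∷ S)                 eq = enum-injective S (suc-injective eq)

index : ∀ {S : Subset n} {x} → x ∈ S → Fin ∣ S ∣
index {S = inside  ∷ S} here      = zero
index {S = inside  ∷ S} (there p) = suc (index p)
index {S = outside ∷ S} (there p) = index p

enum-index : ∀ {S : Subset n} {x} (x∈S : x ∈ S) → enum S (index x∈S) ≡ x
enum-index {S = inside  ∷ S} here      = refl
enum-index {S = inside  ∷ S} (there p) = cong suc (enum-index p)
enum-index {S = outside ∷ S} (there p) = cong suc (enum-index p)

cast-injective : ∀ {m} .(eq : m ≡ n) {k l : Fin m} → cast eq k ≡ cast eq l → k ≡ l
cast-injective eq {k} {l} e = begin
  k                             ≡⟨ cast-involutive (sym eq) eq k ⟨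
  cast (sym eq) (cast eq k)     ≡⟨ cong (cast (sym eq)) e ⟩
  cast (sym eq) (cast eq l)     ≡⟨ cast-involutive (sym eq) eq l ⟩
  l                             ∎
  where open ≡-Reasoning

injection⇒≤∣∣ : ∀ {m} {S : Subset n} (g : Fin m → Fin n) →
  Injective _≡_ _≡_ g → (∀ i → g i ∈ S) → m ≤ ∣ S ∣
injection⇒≤∣∣ {S = S} g g-injective g∈S = injective⇒≤ index∘g-injective
  where
  index∘g-injective : Injective _≡_ _≡_ (index ∘ g∈S)
  index∘g-injective {i} {j} eq =
    g-injective (trans (sym (enum-index (g∈S i))) (trans (cong (enum S) eq) (enum-index (g∈S j))))

∈-tabulate⇒ : ∀ {P : Fin n → Bool} {x} → x ∈ tabulate P → P x ≡ true
∈-tabulate⇒ {P = P} {x} x∈ = trans (sym (lookup∘tabulate P x)) ([]=⇒lookup x∈)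

⇒∈-tabulate : ∀ {P : Fin n → Bool} {x} → P x ≡ true → x ∈ tabulate P
⇒∈-tabulate {P = P} {x} Px = lookup⇒[]= x (tabulate P) (trans (lookup∘tabulate P x) Px)

δ≤degree : ∀ (H : Graph n) v → δ H ≤ degree H v
δ≤degree {n} H v = foldr-⊓≤ (allFin n) (∈-allFin v)
  where
  foldr-⊓≤ : ∀ {m} xs → v List.∈ xs → foldr (λ v m → degree H v ⊓ m) m xs ≤ degree H v
  foldr-⊓≤ (x ∷ₗ xs) (Any.here refl)   = m⊓n≤m _ _
  foldr-⊓≤ (x ∷ₗ xs) (Any.there v∈xs) = ≤-trans (m⊓n≤n _ _) (foldr-⊓≤ xs v∈xs)

Independentᵇ : Graph n → (Fin n → Bool) → Set
Independentᵇ H P = ∀ i j → P i ≡ true → P j ≡ true → H i j ≡ false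


Independent⇒Independentᵇ : ∀ {S} → Independent H S → Independentᵇ H (lookup S)
Independent⇒Independentᵇ {S = S} S-ind i j Si Sj = S-ind i j (lookup⇒[]= i S Si) (lookup⇒[]= j S Sj)

Independentᵇ⇒Independent : ∀ {P} → Independentᵇ H P → Independent H (tabulate P)
Independentᵇ⇒Independent P-ind i j i∈ j∈ = P-ind i j (∈-tabulate⇒ i∈) (∈-tabulate⇒ j∈)

Independentᵇ-∖ : ∀ {P} x → Independentᵇ H P → Independentᵇ H (P ∖ x)
Independentᵇ-∖ {P = P} x P-ind i j Pi Pj = P-ind i j (∖-⊆ P Pi) (∖-⊆ P Pj)

independent? : (H : Graph n) (S : Subset n) → Dec (Independent H S)
independent? H S = all? λ i → all? λ j → (i ∈? S) →-dec (j ∈? S) →-dec (H i j ≟𝔹 false)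

Independent-deleteEdge : ∀ u v {S} → Independent H S → Independent (deleteEdge H u v) S
Independent-deleteEdge u v S-ind i j i∈S j∈S with (i ≡ᵇ u ∧ j ≡ᵇ v) ∨ (i ≡ᵇ v ∧ j ≡ᵇ u)
... | true  = refl
... | false = S-ind i j i∈S j∈S

deleted-edge : ∀ u v i j → deleteEdge H u v i j ≡ false → H i j ≡ true →
  (i ≡ u × j ≡ v) ⊎ (i ≡ v × j ≡ u)
deleted-edge u v i j del Hij with i ≟ u | j ≟ v | i ≟ v | j ≟ u
... | yes refl | yes refl | _        | _        = inj₁ (refl , refl)
... | yes _    | no _     | yes refl | yes refl = inj₂ (refl , refl)
... | no _     | _        | yes refl | yes refl = inj₂ (refl , refl)
... | yes _    | no _     | yes _    | no _     = contradiction (trans (sym del) Hij) λ ()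
... | yes _    | no _     | no _     | _        = contradiction (trans (sym del) Hij) λ ()
... | no _     | _        | yes _    | no _     = contradiction (trans (sym del) Hij) λ ()
... | no _     | _        | no _     | _        = contradiction (trans (sym del) Hij) λ ()

deleteEdge-independent : ∀ {u v P} → Independentᵇ (deleteEdge H u v) P →
  P u ≡ false ⊎ P v ≡ false → Independentᵇ H P
deleteEdge-independent {H = H} {u = u} {v = v} {P = P} P-ind u∉P⊎v∉P i j Pi Pj with H i j in Hij
... | false = refl
... | true with deleted-edge {H = H} u v i j (P-ind i j Pi Pj) Hij | u∉P⊎v∉P
...   | inj₁ (refl , refl) | inj₁ Pu = contradiction (trans (sym Pi) Pu) λ ()
...   | inj₁ (refl , refl) | inj₂ Pv = contradiction (trans (sym Pj) Pv) λ ()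
...   | inj₂ (refl , refl) | inj₁ Pu = contradiction (trans (sym Pj) Pu) λ ()
...   | inj₂ (refl , refl) | inj₂ Pv = contradiction (trans (sym Pi) Pv) λ ()

complement-≢ : ∀ (H : Graph n) {u v} → u ≢ v → complement H u v ≡ not (H u v)
complement-≢ H {u} {v} u≢v with u ≟ v
... | yes u≡v = contradiction u≡v u≢v
... | no _    = refl

critical⇒large-independent : ∀ {r u v} → IsIndepNumber H r → IsAlphaCriticalEdge H u v →
  Σ (Fin n → Bool) λ T → Independentᵇ (deleteEdge H u v) T × r < card T
critical⇒large-independent {H = H} {r = r} {u = u} {v = v} α critical
  with anySubset? (λ T → independent? (deleteEdge H u v) T ×-dec (r <? ∣ T ∣))
... | yes (T , T-ind , r<∣T∣) =
  lookup T , Independent⇒Independentᵇ T-ind , subst (r <_) (card-lookup T) r<∣T∣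
... | no ∄T = contradiction (critical r r α α′) (<-irrefl refl)
  where
  α′ : IsIndepNumber (deleteEdge H u v) r
  α′ = let (S , S-ind , ∣S∣≡r) = proj₁ α in
       (S , Independent-deleteEdge u v S-ind , ∣S∣≡r) ,
       (λ T T-ind → ≮⇒≥ λ r<∣T∣ → ∄T (T , T-ind , r<∣T∣))

InW-disjoint-maximum : ∀ {p} → InW p H →
  Σ (Fin p → Subset n) λ M → (∀ i → IsMaximumIndep H (M i)) × (∀ i j → i ≢ j → Disjoint (M i) (M j))
InW-disjoint-maximum (_ , extend) =
  let (M , M-max , _ , M-disjoint) = extend (λ _ → ⊥) (λ _ _ _ x∈⊥ _ → contradiction x∈⊥ ∉⊥)
                                            (λ _ _ _ _ x∈⊥ _ → ∉⊥ x∈⊥)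
  in M , M-max , M-disjoint

InW-extend : ∀ {p A} → InW (suc p) H → Independent H A →
  Σ (Subset n) λ M → IsMaximumIndep H M × A ⊆ M
InW-extend {n = n} {H = H} {p = p} {A = A} (_ , extend) A-ind =
  let (M , M-max , A⊆M , _) = extend family family-independent family-disjoint
  in M zero , M-max zero , A⊆M zero
  where
  family : Fin (suc p) → Subset n
  family zero    = A
  family (suc _) = ⊥
  family-independent : ∀ i → Independent H (family i)
  family-independent zero    = A-ind
  family-independent (suc _) _ _ x∈⊥ _ = contradiction x∈⊥ ∉⊥
  family-disjoint : ∀ i j → i ≢ j → Disjoint (family i) (family j)
  family-disjoint zero    zero    0≢0 = contradiction refl 0≢0
  family-disjoint zero    (suc _) _ _ _ x∈⊥ = ∉⊥ x∈⊥
  family-disjoint (suc _) _       _ _ x∈⊥ _ = ∉⊥ x∈⊥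

∑-distrib-+₃ : ∀ (f g h : Fin n → ℕ) →
  ∑[ i < n ] (f i + g i + h i) ≡ sum f + sum g + sum h
∑-distrib-+₃ f g h = trans (∑-distrib-+ (λ i → f i + g i) h) (cong (_+ sum h) (∑-distrib-+ f g))

card-∧+∧+∨≤ : ∀ (P Q R : Fin n → Bool) →
  card (λ x → P x ∧ Q x) + card (λ x → Q x ∧ R x) + card (λ x → P x ∨ R x) ≤ card P + card Q + card R
card-∧+∧+∨≤ P Q R = begin
  card (λ x → P x ∧ Q x) + card (λ x → Q x ∧ R x) + card (λ x → P x ∨ R x)
    ≡⟨ ∑-distrib-+₃ (λ x → 𝟙 (P x ∧ Q x)) (λ x → 𝟙 (Q x ∧ R x)) (λ x → 𝟙 (P x ∨ R x)) ⟨
  sum (λ x → 𝟙 (P x ∧ Q x) + 𝟙 (Q x ∧ R x) + 𝟙 (P x ∨ R x))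
    ≤⟨ ∑-mono-≤ (λ x → pointwise (P x) (Q x) (R x)) ⟩
  sum (λ x → 𝟙 (P x) + 𝟙 (Q x) + 𝟙 (R x))
    ≡⟨ ∑-distrib-+₃ (𝟙 ∘ P) (𝟙 ∘ Q) (𝟙 ∘ R) ⟩
  card P + card Q + card R ∎
  where
  open ≤-Reasoning
  pointwise : ∀ a b c → 𝟙 (a ∧ b) + 𝟙 (b ∧ c) + 𝟙 (a ∨ c) ≤ 𝟙 a + 𝟙 b + 𝟙 c
  pointwise true  true  true  = ≤-refl
  pointwise true  true  false = ≤-refl
  pointwise true  false true  = s≤s z≤n
  pointwise true  false false = ≤-refl
  pointwise false true  true  = ≤-refl
  pointwise false true  false = z≤n
  pointwise false false true  = ≤-refl
  pointwise false false false = ≤-refl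

module SimpleGraph {n} (G : Graph n) (G-sym : ∀ i j → G i j ≡ G j i) (G-irrefl : ∀ i → G i i ≡ false) where

  N[_] : Fin n → Fin n → Bool
  N[ v ] x = (v ≡ᵇ x) ∨ G v x

  N-refl : ∀ x → N[ x ] x ≡ true
  N-refl x rewrite ≡ᵇ-refl x = refl

  adj⇒N : ∀ {v x} → G v x ≡ true → N[ v ] x ≡ true
  adj⇒N {v} {x} Gvx rewrite Gvx = ∨-zeroʳ (v ≡ᵇ x)

  N⇒≡⊎adj : ∀ {v x} → N[ v ] x ≡ true → v ≡ x ⊎ G v x ≡ true
  N⇒≡⊎adj {v} {x} Nvx with v ≟ x
  ... | yes v≡x = inj₁ v≡x
  ... | no _    = inj₂ Nvx

  N-sym : ∀ {v x} → N[ v ] x ≡ true → N[ x ] v ≡ true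
  N-sym Nvx with N⇒≡⊎adj Nvx
  ... | inj₁ refl = N-refl _
  ... | inj₂ Gvx  = adj⇒N (trans (G-sym _ _) Gvx)

  adj⇒≢ : ∀ {u v} → G u v ≡ true → u ≢ v
  adj⇒≢ {u} Guv refl = contradiction (trans (sym Guv) (G-irrefl u)) λ ()

  Dominates : (Fin n → Bool) → Fin n → Set
  Dominates P x = Σ (Fin n) λ y → P y ≡ true × N[ y ] x ≡ true

  Covers : (K Z : Fin n → Bool) → Set
  Covers K Z = ∀ x → Dominates K x ⊎ Z x ≡ true

  covered-count : ∀ {K Z} → Covers K Z → n ≤ ∑[ y < n ] (𝟙 (K y) * card N[ y ]) + card Z
  covered-count {K} {Z} covers = begin
    n                                               ≡⟨ ∑-one n ⟨
    ∑[ x < n ] 1                                    ≤⟨ ∑-mono-≤ pointwise ⟩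
    ∑[ x < n ] (∑[ y < n ] hit x y + 𝟙 (Z x))       ≡⟨ ∑-distrib-+ (λ x → ∑[ y < n ] hit x y) (𝟙 ∘ Z) ⟩
    ∑[ x < n ] ∑[ y < n ] hit x y + card Z          ≡⟨ cong (_+ card Z) (∑-comm hit) ⟩
    ∑[ y < n ] ∑[ x < n ] hit x y + card Z          ≡⟨ cong (_+ card Z) (sum-cong-≗ λ y →
                                                         *-distribˡ-sum (𝟙 (K y)) (𝟙 ∘ N[ y ])) ⟨
    ∑[ y < n ] (𝟙 (K y) * card N[ y ]) + card Z     ∎
    where
    open ≤-Reasoning
    hit : Fin n → Fin n → ℕ
    hit x y = 𝟙 (K y) * 𝟙 (N[ y ] x)
    pointwise : ∀ x → 1 ≤ ∑[ y < n ] hit x y + 𝟙 (Z x)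
    pointwise x with covers x
    ... | inj₁ (y , Ky , Nyx) = begin
      1                              ≡⟨ cong₂ (λ a b → 𝟙 a * 𝟙 b) Ky Nyx ⟨
      hit x y                        ≤⟨ term≤∑ (hit x) y ⟩
      ∑[ y < n ] hit x y             ≤⟨ m≤m+n _ _ ⟩
      ∑[ y < n ] hit x y + 𝟙 (Z x)   ∎
    ... | inj₂ Zx rewrite Zx = m≤n+m 1 _

  domination-bound : ∀ {c b K Z} → (∀ y → c * card N[ y ] ≤ b) → Covers K Z →
    c * n ≤ b * card K + c * card Z
  domination-bound {c} {b} {K} {Z} bound covers = begin
    c * n                                     ≤⟨ *-monoʳ-≤ c (covered-count covers) ⟩
    c * (∑[ y < n ] load y + card Z)          ≡⟨ *-distribˡ-+ c _ (card Z) ⟩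
    c * ∑[ y < n ] load y + c * card Z        ≡⟨ cong (_+ c * card Z) (*-distribˡ-sum c load) ⟩
    ∑[ y < n ] (c * load y) + c * card Z      ≤⟨ +-monoˡ-≤ (c * card Z) (∑-mono-≤ pointwise) ⟩
    ∑[ y < n ] (b * 𝟙 (K y)) + c * card Z     ≡⟨ cong (_+ c * card Z) (*-distribˡ-sum b (𝟙 ∘ K)) ⟨
    b * card K + c * card Z                   ∎
    where
    open ≤-Reasoning
    load : Fin n → ℕ
    load y = 𝟙 (K y) * card N[ y ]
    pointwise : ∀ y → c * load y ≤ b * 𝟙 (K y)
    pointwise y with K y
    ... | true  = subst₂ _≤_ (cong (c *_) (sym (*-identityˡ _))) (sym (*-identityʳ b)) (bound y)
    ... | false = ≤-reflexive (trans (*-zeroʳ c) (sym (*-zeroʳ b)))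

  pair-independent : ∀ {u w} → G u w ≡ false → Independent G (⁅ u ⁆ ∪ ⁅ w ⁆)
  pair-independent {u} {w} Guw i j i∈ j∈ with x∈p∪q⁻ ⁅ u ⁆ ⁅ w ⁆ i∈ | x∈p∪q⁻ ⁅ u ⁆ ⁅ w ⁆ j∈
  ... | inj₁ i∈⁅u⁆ | inj₁ j∈⁅u⁆ rewrite x∈⁅y⁆⇒x≡y u i∈⁅u⁆ | x∈⁅y⁆⇒x≡y u j∈⁅u⁆ = G-irrefl u
  ... | inj₁ i∈⁅u⁆ | inj₂ j∈⁅w⁆ rewrite x∈⁅y⁆⇒x≡y u i∈⁅u⁆ | x∈⁅y⁆⇒x≡y w j∈⁅w⁆ = Guw
  ... | inj₂ i∈⁅w⁆ | inj₁ j∈⁅u⁆ rewrite x∈⁅y⁆⇒x≡y w i∈⁅w⁆ | x∈⁅y⁆⇒x≡y u j∈⁅u⁆ = trans (G-sym w u) Guw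
  ... | inj₂ i∈⁅w⁆ | inj₂ j∈⁅w⁆ rewrite x∈⁅y⁆⇒x≡y w i∈⁅w⁆ | x∈⁅y⁆⇒x≡y w j∈⁅w⁆ = G-irrefl w

  module Independence {r} (α : IsIndepNumber G r) where

    independent-card≤ : ∀ {P} → Independentᵇ G P → card P ≤ r
    independent-card≤ {P} P-ind =
      subst (_≤ r) (card-tabulate P) (proj₂ α _ (Independentᵇ⇒Independent P-ind))

    maximum-card : ∀ {M} → IsMaximumIndep G M → r ≤ card (lookup M)
    maximum-card {M} (_ , M-max) =
      let (S , S-ind , ∣S∣≡r) = proj₁ α in subst₂ _≤_ ∣S∣≡r (card-lookup M) (M-max S S-ind)

    large-independent-dominates : ∀ {P} → Independentᵇ G P → r ≤ card P → ∀ x → Dominates P x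
    large-independent-dominates {P} P-ind r≤∣P∣ x
      with any? (λ y → (P y ≟𝔹 true) ×-dec (N[ y ] x ≟𝔹 true))
    ... | yes dominated = dominated
    ... | no ¬dominated = contradiction (independent-card≤ P+x-independent) (<⇒≱ r<∣P+x∣)
      where
      x∉P : P x ≡ false
      x∉P with P x in Px
      ... | true  = contradiction (x , Px , N-refl x) ¬dominated
      ... | false = refl
      x-isolated : ∀ y → P y ≡ true → G y x ≡ false
      x-isolated y Py with G y x in Gyx
      ... | true  = contradiction (y , Py , adj⇒N Gyx) ¬dominated
      ... | false = refl
      P+x : Fin n → Bool
      P+x y = P y ∨ y ≡ᵇ x
      P+x-independent : Independentᵇ G P+x
      P+x-independent i j i∈ j∈ with ∪-singleton⁻ {P = P} i∈ | ∪-singleton⁻ {P = P} j∈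
      ... | inj₁ Pi    | inj₁ Pj    = P-ind i j Pi Pj
      ... | inj₁ Pi    | inj₂ refl  = x-isolated i Pi
      ... | inj₂ refl  | inj₁ Pj    = trans (G-sym x j) (x-isolated j Pj)
      ... | inj₂ refl  | inj₂ refl  = G-irrefl x
      r<∣P+x∣ : r < card P+x
      r<∣P+x∣ = subst (r <_) (sym (card-∪-singleton P x∉P)) (s≤s r≤∣P∣)

    critical-edge-cover : ∀ {u v} → G u v ≡ true → IsAlphaCriticalEdge G u v →
      Σ (Fin n → Bool) λ J → suc (card J) ≤ r × Covers J (λ x → N[ u ] x ∧ N[ v ] x)
    critical-edge-cover {u} {v} Guv critical with critical⇒large-independent α critical
    ... | T , T-ind , r<∣T∣ = J , suc∣J∣≤r , covers
      where
      T-dependent : ¬ (T u ≡ false ⊎ T v ≡ false)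
      T-dependent uv∉T = <⇒≱ r<∣T∣ (independent-card≤ (deleteEdge-independent T-ind uv∉T))
      Tu : T u ≡ true
      Tu = ¬-not (T-dependent ∘ inj₁)
      Tv : T v ≡ true
      Tv = ¬-not (T-dependent ∘ inj₂)
      Tᵤ Tᵥ J : Fin n → Bool
      Tᵤ = T ∖ u
      Tᵥ = T ∖ v
      J  = Tᵥ ∖ u
      Tᵤ-ind : Independentᵇ G Tᵤ
      Tᵤ-ind = deleteEdge-independent (Independentᵇ-∖ u T-ind) (inj₁ (∖-self T u))
      Tᵥ-ind : Independentᵇ G Tᵥ
      Tᵥ-ind = deleteEdge-independent (Independentᵇ-∖ v T-ind) (inj₂ (∖-self T v))
      Tᵤ-large : r ≤ card Tᵤ
      Tᵤ-large = ≤-pred (subst (r <_) (card-∖ T Tu) r<∣T∣)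
      Tᵥ-large : r ≤ card Tᵥ
      Tᵥ-large = ≤-pred (subst (r <_) (card-∖ T Tv) r<∣T∣)
      suc∣J∣≤r : suc (card J) ≤ r
      suc∣J∣≤r = subst (_≤ r) (card-∖ Tᵥ (∈-∖ T Tu (adj⇒≢ Guv))) (independent-card≤ Tᵥ-ind)
      covers : Covers J (λ x → N[ u ] x ∧ N[ v ] x)
      covers x with large-independent-dominates Tᵥ-ind Tᵥ-large x
                  | large-independent-dominates Tᵤ-ind Tᵤ-large x
      ... | y , y∈Tᵥ , Nyx | z , z∈Tᵤ , Nzx with y ≟ u | z ≟ v
      ...   | no y≢u   | _        = inj₁ (y , ∈-∖ Tᵥ y∈Tᵥ y≢u , Nyx)
      ...   | yes refl | no z≢v   = inj₁ (z , ∈-∖ Tᵥ (∈-∖ T (∖-⊆ T z∈Tᵤ) z≢v) (∖-≢ T z∈Tᵤ) , Nzx)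
      ...   | yes refl | yes refl rewrite Nyx = inj₂ Nzx

    nonadjacent-cover : ∀ {p u w} → InW (suc p) G → u ≢ w → G u w ≡ false →
      Σ (Fin n → Bool) λ K → 2 + card K ≤ r × Covers K (λ x → N[ u ] x ∨ N[ w ] x)
    nonadjacent-cover {u = u} {w} W u≢w Guw with InW-extend W (pair-independent Guw)
    ... | M , M-max , uw⊆M = K , 2+∣K∣≤r , covers
      where
      m K : Fin n → Bool
      m = lookup M
      K = (m ∖ u) ∖ w
      m-ind : Independentᵇ G m
      m-ind = Independent⇒Independentᵇ (proj₁ M-max)
      mu : m u ≡ true
      mu = []=⇒lookup (uw⊆M (x∈p∪q⁺ (inj₁ (x∈⁅x⁆ u))))
      mw : m w ≡ true
      mw = []=⇒lookup (uw⊆M (x∈p∪q⁺ (inj₂ (x∈⁅x⁆ w))))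
      2+∣K∣≤r : 2 + card K ≤ r
      2+∣K∣≤r = subst (_≤ r) (trans (card-∖ m mu) (cong suc (card-∖ (m ∖ u) (∈-∖ m mw (u≢w ∘ sym)))))
                       (independent-card≤ m-ind)
      covers : Covers K (λ x → N[ u ] x ∨ N[ w ] x)
      covers x with large-independent-dominates m-ind (maximum-card M-max) x
      ... | y , my , Nyx with y ≟ u | y ≟ w
      ...   | yes refl | _        rewrite Nyx = inj₂ refl
      ...   | no _     | yes refl rewrite Nyx = inj₂ (∨-zeroʳ (N[ u ] x))
      ...   | no y≢u   | no y≢w   = inj₁ (y , ∈-∖ (m ∖ u) (∈-∖ m my y≢u) y≢w , Nyx)

  card-N+degree : ∀ v → card N[ v ] + degree (complement G) v ≡ n
  card-N+degree v = begin
    card N[ v ] + degree (complement G) v               ≡⟨ cong (card N[ v ] +_) (card-tabulate (complement G v)) ⟩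
    card N[ v ] + card (complement G v)                 ≡⟨ ∑-distrib-+ (𝟙 ∘ N[ v ]) (𝟙 ∘ complement G v) ⟨
    ∑[ x < n ] (𝟙 (N[ v ] x) + 𝟙 (complement G v x))    ≡⟨ sum-cong-≗ pointwise ⟩
    ∑[ x < n ] 1                                        ≡⟨ ∑-one n ⟩
    n                                                   ∎
    where
    open ≡-Reasoning
    pointwise : ∀ x → 𝟙 (N[ v ] x) + 𝟙 (complement G v x) ≡ 1
    pointwise x with v ≟ x | G v x
    ... | yes _ | _     = refl
    ... | no _  | true  = refl
    ... | no _  | false = refl

  -- Below r = 2 + q, so that 3q + 5 = 3r − 1 and 3q + 2 = 3r − 4.
  sparse-neighbourhoods : ∀ q → (3 * q + 2) * n < (3 * q + 5) * δ (complement G) →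
    ∀ v → (3 * q + 5) * card N[ v ] < 3 * n
  sparse-neighbourhoods q dense v = +-cancelʳ-< ((3 * q + 2) * n) _ (3 * n) (begin-strict
    (3 * q + 5) * card N[ v ] + (3 * q + 2) * n
      <⟨ +-monoʳ-< _ (<-≤-trans dense (*-monoʳ-≤ (3 * q + 5) (δ≤degree (complement G) v))) ⟩
    (3 * q + 5) * card N[ v ] + (3 * q + 5) * degree (complement G) v
      ≡⟨ *-distribˡ-+ (3 * q + 5) (card N[ v ]) _ ⟨
    (3 * q + 5) * (card N[ v ] + degree (complement G) v)
      ≡⟨ cong ((3 * q + 5) *_) (card-N+degree v) ⟩
    (3 * q + 5) * n
      ≡⟨ split q n ⟩
    3 * n + (3 * q + 2) * n ∎)
    where
    open ≤-Reasoning
    split : ∀ q n → (3 * q + 5) * n ≡ 3 * n + (3 * q + 2) * n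
    split = solve-∀

  module Dense (q : ℕ) (α : IsIndepNumber G (2 + q))
               (sparse : ∀ v → (3 * q + 5) * card N[ v ] < 3 * n) where
    open Independence α

    bounded : ∀ v → (3 * q + 5) * card N[ v ] ≤ 3 * n
    bounded v = <⇒≤ (sparse v)

    common-neighbourhood-large : ∀ {u v} → G u v ≡ true → IsAlphaCriticalEdge G u v →
      2 * n ≤ (3 * q + 5) * card (λ x → N[ u ] x ∧ N[ v ] x)
    common-neighbourhood-large {u} {v} Guv critical with critical-edge-cover Guv critical
    ... | J , suc∣J∣≤r , covers = +-cancelˡ-≤ (3 * n * suc q) _ _ (begin
      3 * n * suc q + 2 * n                     ≡⟨ split q n ⟩
      (3 * q + 5) * n                           ≤⟨ domination-bound {c = 3 * q + 5} bounded covers ⟩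
      3 * n * card J + (3 * q + 5) * card Z     ≤⟨ +-monoˡ-≤ _ (*-monoʳ-≤ (3 * n) (≤-pred suc∣J∣≤r)) ⟩
      3 * n * suc q + (3 * q + 5) * card Z      ∎)
      where
      open ≤-Reasoning
      Z : Fin n → Bool
      Z x = N[ u ] x ∧ N[ v ] x
      split : ∀ q n → 3 * n * suc q + 2 * n ≡ (3 * q + 5) * n
      split = solve-∀

    union-neighbourhood-large : ∀ {p u w} → InW (suc p) G → u ≢ w → G u w ≡ false →
      5 * n ≤ (3 * q + 5) * card (λ x → N[ u ] x ∨ N[ w ] x)
    union-neighbourhood-large {u = u} {w} W u≢w Guw with nonadjacent-cover W u≢w Guw
    ... | K , 2+∣K∣≤r , covers = +-cancelˡ-≤ (3 * n * q) _ _ (begin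
      3 * n * q + 5 * n                         ≡⟨ split q n ⟩
      (3 * q + 5) * n                           ≤⟨ domination-bound {c = 3 * q + 5} bounded covers ⟩
      3 * n * card K + (3 * q + 5) * card Z     ≤⟨ +-monoˡ-≤ _ (*-monoʳ-≤ (3 * n) (≤-pred (≤-pred 2+∣K∣≤r))) ⟩
      3 * n * q + (3 * q + 5) * card Z          ∎)
      where
      open ≤-Reasoning
      Z : Fin n → Bool
      Z x = N[ u ] x ∨ N[ w ] x
      split : ∀ q n → 3 * n * q + 5 * n ≡ (3 * q + 5) * n
      split = solve-∀

    adjacency-transitive : ∀ {p} → IsAlphaCritical G → InW (suc p) G →
      ∀ {a b d} → a ≢ d → G a b ≡ true → G b d ≡ true → G a d ≡ true
    adjacency-transitive critical W {a} {b} {d} a≢d Gab Gbd with G a d in Gad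
    ... | true  = refl
    ... | false = contradiction lower (<⇒≱ upper)
      where
      open ≤-Reasoning
      c total : ℕ
      c     = 3 * q + 5
      total = card N[ a ] + card N[ b ] + card N[ d ]
      Nab Nbd Nad : Fin n → Bool
      Nab x = N[ a ] x ∧ N[ b ] x
      Nbd x = N[ b ] x ∧ N[ d ] x
      Nad x = N[ a ] x ∨ N[ d ] x
      regroup : ∀ n → 2 * n + 2 * n + 5 * n ≡ 3 * n + 3 * n + 3 * n
      regroup = solve-∀
      distrib₃ : ∀ c x y z → c * (x + y + z) ≡ c * x + c * y + c * z
      distrib₃ = solve-∀
      lower : 3 * n + 3 * n + 3 * n ≤ c * total
      lower = begin
        3 * n + 3 * n + 3 * n                        ≡⟨ regroup n ⟨
        2 * n + 2 * n + 5 * n                        ≤⟨ +-mono-≤ (+-mono-≤ Nab-large Nbd-large) Nad-large ⟩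
        c * card Nab + c * card Nbd + c * card Nad   ≡⟨ distrib₃ c _ _ _ ⟨
        c * (card Nab + card Nbd + card Nad)         ≤⟨ *-monoʳ-≤ c (card-∧+∧+∨≤ N[ a ] N[ b ] N[ d ]) ⟩
        c * total                                    ∎
        where
        Nab-large : 2 * n ≤ c * card Nab
        Nab-large = common-neighbourhood-large Gab (critical a b Gab)
        Nbd-large : 2 * n ≤ c * card Nbd
        Nbd-large = common-neighbourhood-large Gbd (critical b d Gbd)
        Nad-large : 5 * n ≤ c * card Nad
        Nad-large = union-neighbourhood-large W a≢d Gad
      upper : c * total < 3 * n + 3 * n + 3 * n
      upper = begin-strict
        c * total                                              ≡⟨ distrib₃ c _ _ _ ⟩
        c * card N[ a ] + c * card N[ b ] + c * card N[ d ]
          <⟨ +-mono-< (+-mono-< (sparse a) (sparse b)) (sparse d) ⟩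
        3 * n + 3 * n + 3 * n                                  ∎

  module Cluster (adj-trans : ∀ {a b d} → a ≢ d → G a b ≡ true → G b d ≡ true → G a d ≡ true)
                 {r} (α : IsIndepNumber G r) where
    open Independence α

    N-adj : ∀ {y u v} → N[ y ] u ≡ true → G u v ≡ true → N[ y ] v ≡ true
    N-adj {y} {u} {v} Nyu Guv with y ≟ v
    ... | yes _   = refl
    ... | no y≢v with N⇒≡⊎adj Nyu
    ...   | inj₁ refl = Guv
    ...   | inj₂ Gyu  = adj-trans y≢v Gyu Guv

    N-join : ∀ {y u v} → N[ y ] u ≡ true → N[ y ] v ≡ true → u ≢ v → G u v ≡ true
    N-join Nyu Nyv u≢v with N⇒≡⊎adj Nyu | N⇒≡⊎adj Nyv
    ... | inj₁ refl | inj₁ refl = contradiction refl u≢v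
    ... | inj₁ refl | inj₂ Gyv  = Gyv
    ... | inj₂ Gyu  | inj₁ refl = trans (G-sym _ _) Gyu
    ... | inj₂ Gyu  | inj₂ Gyv  = adj-trans u≢v (trans (G-sym _ _) Gyu) Gyv

    S : Subset n
    S = proj₁ (proj₁ α)

    ∣S∣≡r : ∣ S ∣ ≡ r
    ∣S∣≡r = proj₂ (proj₂ (proj₁ α))

    S-ind : Independentᵇ G (lookup S)
    S-ind = Independent⇒Independentᵇ (proj₁ (proj₂ (proj₁ α)))

    S-dominates : ∀ x → Dominates (lookup S) x
    S-dominates = large-independent-dominates S-ind (≤-reflexive (trans (sym ∣S∣≡r) (card-lookup S)))

    rep : Fin n → Fin n
    rep x = proj₁ (S-dominates x)

    rep-∈ : ∀ x → rep x ∈ S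
    rep-∈ x = lookup⇒[]= (rep x) S (proj₁ (proj₂ (S-dominates x)))

    N-rep : ∀ x → N[ rep x ] x ≡ true
    N-rep x = proj₂ (proj₂ (S-dominates x))

    rep-unique : ∀ {y x} → y ∈ S → N[ y ] x ≡ true → rep x ≡ y
    rep-unique {y} {x} y∈S Nyx with rep x ≟ y
    ... | yes rep≡y = rep≡y
    ... | no rep≢y  = contradiction
      (trans (sym (N-join (N-sym (N-rep x)) (N-sym Nyx) rep≢y))
             (S-ind _ _ (proj₁ (proj₂ (S-dominates x))) ([]=⇒lookup y∈S))) λ ()

    part : Fin n → Fin r
    part x = cast ∣S∣≡r (index (rep-∈ x))

    part-rep : ∀ x k → rep x ≡ enum S k → part x ≡ cast ∣S∣≡r k
    part-rep x k rep≡ = cong (cast ∣S∣≡r) (enum-injective S (trans (enum-index (rep-∈ x)) rep≡))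

    same-rep⇒same-part : ∀ {u v} → rep u ≡ rep v → part u ≡ part v
    same-rep⇒same-part {u} {v} rep≡ = part-rep u (index (rep-∈ v)) (trans rep≡ (sym (enum-index (rep-∈ v))))

    same-part⇒same-rep : ∀ {u v} → part u ≡ part v → rep u ≡ rep v
    same-part⇒same-rep {u} {v} part≡ = begin
      rep u                     ≡⟨ enum-index (rep-∈ u) ⟨
      enum S (index (rep-∈ u))  ≡⟨ cong (enum S) (cast-injective ∣S∣≡r part≡) ⟩
      enum S (index (rep-∈ v))  ≡⟨ enum-index (rep-∈ v) ⟩
      rep v                     ∎
      where open ≡-Reasoning

    adj⇒same-part : ∀ {u v} → G u v ≡ true → part u ≡ part v
    adj⇒same-part {u} Guv = same-rep⇒same-part (sym (rep-unique (rep-∈ u) (N-adj (N-rep u) Guv)))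

    same-part⇒adj : ∀ {u v} → part u ≡ part v → u ≢ v → G u v ≡ true
    same-part⇒adj {u} {v} part≡ =
      N-join (N-rep u) (subst (λ y → N[ y ] v ≡ true) (sym (same-part⇒same-rep part≡)) (N-rep v))

    complement-multipartite : IsCompleteMultipartiteVia (complement G) r part
    complement-multipartite u v u≢v = different-parts , across-parts
      where
      different-parts : complement G u v ≡ true → part u ≢ part v
      different-parts Huv part≡ = contradiction
        (trans (sym Huv) (trans (complement-≢ G u≢v) (cong not (same-part⇒adj part≡ u≢v)))) λ ()
      across-parts : part u ≢ part v → complement G u v ≡ true
      across-parts part≢ = trans (complement-≢ G u≢v) (cong not (¬-not (part≢ ∘ adj⇒same-part)))

    part-size : ∀ {p} → InW p G → ∀ k → p ≤ partSize part k
    part-size {p} W k with InW-disjoint-maximum W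
    ... | M , M-max , M-disjoint = injection⇒≤∣∣ g g-injective g∈part
      where
      y : Fin n
      y = enum S (cast (sym ∣S∣≡r) k)
      dominator : ∀ i → Dominates (lookup (M i)) y
      dominator i = large-independent-dominates (Independent⇒Independentᵇ (proj₁ (M-max i)))
                                                (maximum-card (M-max i)) y
      g : Fin p → Fin n
      g i = proj₁ (dominator i)
      g∈M : ∀ i → g i ∈ M i
      g∈M i = lookup⇒[]= (g i) (M i) (proj₁ (proj₂ (dominator i)))
      g-injective : Injective _≡_ _≡_ g
      g-injective {i} {j} gi≡gj with i ≟ j
      ... | yes i≡j = i≡j
      ... | no i≢j  = contradiction (subst (_∈ M j) (sym gi≡gj) (g∈M j)) (M-disjoint i j i≢j (g i) (g∈M i))
      part-g : ∀ i → part (g i) ≡ k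
      part-g i = trans (part-rep (g i) _ (rep-unique (enum-∈ S _) (N-sym (proj₂ (proj₂ (dominator i))))))
                       (cast-involutive ∣S∣≡r (sym ∣S∣≡r) k)
      g∈part : ∀ i → g i ∈ tabulate (λ v → part v ≡ᵇ k)
      g∈part i = ⇒∈-tabulate (subst (λ l → (l ≡ᵇ k) ≡ true) (sym (part-g i)) (≡ᵇ-refl k))

3r∸4≡ : ∀ q → 3 * (2 + q) ∸ 4 ≡ 3 * q + 2
3r∸4≡ q = trans (cong (_∸ 4) (expand q)) (m+n∸m≡n 4 (3 * q + 2))
  where
  expand : ∀ q → 3 * (2 + q) ≡ 4 + (3 * q + 2)
  expand = solve-∀

3r∸1≡ : ∀ q → 3 * (2 + q) ∸ 1 ≡ 3 * q + 5
3r∸1≡ q = trans (cong (_∸ 1) (expand q)) (m+n∸m≡n 1 (3 * q + 5))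
  where
  expand : ∀ q → 3 * (2 + q) ≡ 1 + (3 * q + 5)
  expand = solve-∀

corollary6p3 : (p n r : ℕ) → 1 ≤ p → 1 ≤ n → (G : Graph n) → IsSimple G →
    IsAlphaCritical G → InW p G → IsIndepNumber G r → 2 ≤ r →
    (3 * r ∸ 4) * n < (3 * r ∸ 1) * δ (complement G) →
    Σ (Fin n → Fin r) λ part →
      IsCompleteMultipartiteVia (complement G) r part ×
      (∀ (k : Fin r) → p ≤ partSize part k)
corollary6p3 (suc p) n (suc (suc q)) (s≤s z≤n) _ G (G-sym , G-irrefl) critical W α (s≤s (s≤s z≤n)) dense =
  part , complement-multipartite , part-size W
  where
  open SimpleGraph G G-sym G-irrefl
  dense′ : (3 * q + 2) * n < (3 * q + 5) * δ (complement G)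
  dense′ = subst₂ (λ a b → a * n < b * δ (complement G)) (3r∸4≡ q) (3r∸1≡ q) dense
  open Dense q α (sparse-neighbourhoods q dense′)
  open Cluster (adjacency-transitive critical W) α
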